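{- The relation $\to_{R_2/ACh}$ is terminating.
   Context: Terms are over $\{+,h,0\}$, variables and free constants. $R_2$ is the rewrite system $x+x\to0$, $x+0\to x$, $x+(y+x)\to y$, $h(0)\to0$. $ACh$ is the equational theory generated by associativity and commutativity of $+$ and $h(x+y)\approx h(x)+h(y)$. The relation $\to_{R_2/ACh}$ is $=_{ACh}\circ\to_{R_2}\circ=_{ACh}$. -}

module Defs where

open import Data.Nat using (ℕ)
open import Induction.WellFounded using (WellFounded)

infixl 6 _⊕_
data Term : Set where
  var   : ℕ → Term
  const : ℕ → Term
  𝟘     : Term
  _⊕_   : Term → Term → Term
  h     : Term → Term

data _≈ACh_ : Term → Term → Set where
  assoc  : ∀ x y z → ((x ⊕ y) ⊕ z) ≈ACh (x ⊕ (y ⊕ z))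
  comm   : ∀ x y → (x ⊕ y) ≈ACh (y ⊕ x)
  hdist  : ∀ x y → h (x ⊕ y) ≈ACh (h x ⊕ h y)
  refl   : ∀ {s} → s ≈ACh s
  sym    : ∀ {s t} → s ≈ACh t → t ≈ACh s
  trans  : ∀ {s t u} → s ≈ACh t → t ≈ACh u → s ≈ACh u
  ⊕-cong : ∀ {s s′ t t′} → s ≈ACh s′ → t ≈ACh t′ → (s ⊕ t) ≈ACh (s′ ⊕ t′)
  h-cong : ∀ {s s′} → s ≈ACh s′ → h s ≈ACh h s′

data _⟶R₂_ : Term → Term → Set where
  r-xx   : ∀ x → (x ⊕ x) ⟶R₂ 𝟘
  r-x0   : ∀ x → (x ⊕ 𝟘) ⟶R₂ x
  r-xyx  : ∀ x y → (x ⊕ (y ⊕ x)) ⟶R₂ y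
  r-h0   : h 𝟘 ⟶R₂ 𝟘
  ⊕-l    : ∀ {s s′ t} → s ⟶R₂ s′ → (s ⊕ t) ⟶R₂ (s′ ⊕ t)
  ⊕-r    : ∀ {s t t′} → t ⟶R₂ t′ → (s ⊕ t) ⟶R₂ (s ⊕ t′)
  h-c    : ∀ {s s′} → s ⟶R₂ s′ → h s ⟶R₂ h s′

data _⟶R₂/ACh_ : Term → Term → Set where
  step : ∀ {s s′ t′ t} → s ≈ACh s′ → s′ ⟶R₂ t′ → t′ ≈ACh t → s ⟶R₂/ACh t

-- Termination of a relation _⟶_: every term is accessible for the converse
-- relation (no infinite chain t₀ ⟶ t₁ ⟶ …), in the standard constructive form.
Terminating : (Term → Term → Set) → Set
Terminating _⟶_ = WellFounded (λ t s → s ⟶ t)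

module Submission where

open import Defs
open import Data.Nat using (ℕ; suc; _+_; _<_; s≤s; z≤n)
open import Data.Nat.Properties
  using (m≤m+n; m≤n+m; n≤1+n; ≤-trans; +-comm; +-monoˡ-<; +-monoʳ-<; +-mono-<)
open import Data.Nat.Induction using (<-wellFounded)
open import Data.Nat.Tactic.RingSolver using (solve-∀)
open import Induction.WellFounded using (module Subrelation)
open import Relation.Binary.Construct.On as On using ()
open import Relation.Binary.PropositionalEquality as Eq using (_≡_; cong; cong₂)

-- Interpret terms by the polynomial weight below (+ ↦ 1 + x + y, h ↦ 1 + 2x).
-- It is invariant under ACh (both sides of h(x+y) ≈ h(x)+h(y) weigh
-- 3 + 2x + 2y), and since both interpretations are strictly monotone every
-- R₂-step in any context lowers it; so R₂/ACh-steps decrease a natural number.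

weight : Term → ℕ
weight (var _)   = 0
weight (const _) = 0
weight 𝟘         = 0
weight (s ⊕ t)   = suc (weight s + weight t)
weight (h s)     = suc (weight s + weight s)

⊕-weight-assoc : ∀ a b c → suc (suc (a + b) + c) ≡ suc (a + suc (b + c))
⊕-weight-assoc = solve-∀

h-weight-distrib : ∀ a b →
  suc (suc (a + b) + suc (a + b)) ≡ suc (suc (a + a) + suc (b + b))
h-weight-distrib = solve-∀

weight-cong : ∀ {s t} → s ≈ACh t → weight s ≡ weight t
weight-cong (assoc x y z) = ⊕-weight-assoc (weight x) (weight y) (weight z)
weight-cong (comm x y)    = cong suc (+-comm (weight x) (weight y))
weight-cong (hdist x y)   = h-weight-distrib (weight x) (weight y)
weight-cong refl          = Eq.refl
weight-cong (sym p)       = Eq.sym (weight-cong p)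
weight-cong (trans p q)   = Eq.trans (weight-cong p) (weight-cong q)
weight-cong (⊕-cong p q)  = cong suc (cong₂ _+_ (weight-cong p) (weight-cong q))
weight-cong (h-cong p)    = cong suc (cong₂ _+_ (weight-cong p) (weight-cong p))

⟶R₂-weight-< : ∀ {s t} → s ⟶R₂ t → weight t < weight s
⟶R₂-weight-< (r-xx x)    = s≤s z≤n
⟶R₂-weight-< (r-x0 x)    = s≤s (m≤m+n (weight x) 0)
⟶R₂-weight-< (r-xyx x y) =
  s≤s (≤-trans (m≤m+n (weight y) (weight x))
               (≤-trans (n≤1+n _) (m≤n+m _ (weight x))))
⟶R₂-weight-< r-h0        = s≤s z≤n
⟶R₂-weight-< (⊕-l {t = t} p) = s≤s (+-monoˡ-< (weight t) (⟶R₂-weight-< p))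
⟶R₂-weight-< (⊕-r {s = s} p) = s≤s (+-monoʳ-< (weight s) (⟶R₂-weight-< p))
⟶R₂-weight-< (h-c p)     = s≤s (+-mono-< (⟶R₂-weight-< p) (⟶R₂-weight-< p))

⟶R₂/ACh-weight-< : ∀ {s t} → s ⟶R₂/ACh t → weight t < weight s
⟶R₂/ACh-weight-< (step s≈s′ s′⟶t′ t′≈t)
  rewrite weight-cong s≈s′ | Eq.sym (weight-cong t′≈t) = ⟶R₂-weight-< s′⟶t′

mainTheorem7 : Terminating _⟶R₂/ACh_
mainTheorem7 =
  Subrelation.wellFounded ⟶R₂/ACh-weight-< (On.wellFounded weight <-wellFounded)
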